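{- Let $G$ be a finite abelian group with identity $1$, let $S$ be an inverse-closed subset of $G\setminus\{1\}$ with $|S|\ge 3$, let $s\in S$ be such that $H=\langle S\setminus\{s,s^{ -1}\}\rangle \neq G$, and let $\Gamma=\mathrm{Cay}(G;S)$. Suppose $[G:H]=2$ and the order of $s$ is at least $6$. If $\Gamma$ is distance-regular with intersection number $a_1=2$, then $\Gamma$ is isomorphic to the complete tripartite graph $K_{2,2,2}$.
   Context: The Cayley graph $\mathrm{Cay}(G;S)$ has vertex set $G$, with $g$ adjacent to $h$ iff $h=gs'$ for some $s'\in S$. A connected graph $\Gamma$ with distance $\partial$ is distance-regular if for each $i$ up to the diameter the numbers $c_i(x,y)=|N_{i-1}(x)\cap N(y)|$, $a_i(x,y)=|N_i(x)\cap N(y)|$, $b_i(x,y)=|N_{i+1}(x)\cap N(y)|$ depend only on $i=\partial(x,y)$; their common values are the intersection numbers $c_i,a_i,b_i$. Here $N_j(x)$ is the set of vertices at distance $j$ from $x$ and $N(y)=N_1(y)$. -}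

module Defs where

open import Level using (0ℓ)
open import Data.Nat using (ℕ; zero; suc; _<_; _≤_)
open import Data.Fin using (Fin)
open import Data.Product using (Σ; _×_; ∃; _,_)
open import Data.List using (List; length)
open import Data.List.Membership.Propositional using (_∈_)
open import Data.List.Relation.Unary.Unique.Propositional using (Unique)
open import Relation.Binary.PropositionalEquality using (_≡_; _≢_)
open import Relation.Nullary using (¬_)
open import Function.Bundles using (_↔_; _⇔_; Inverse)
open import Algebra.Structures using (IsAbelianGroup)

record FiniteAbelianGroup : Set₁ where
  field
    Carrier        : Set
    _∙_            : Carrier → Carrier → Carrier
    ε              : Carrier
    _⁻¹            : Carrier → Carrier
    isAbelianGroup : IsAbelianGroup _≡_ _∙_ ε _⁻¹
    size           : ℕ
    enum           : Fin size ↔ Carrier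

  infixl 7 _∙_
  infix 8 _⁻¹

  _^_ : Carrier → ℕ → Carrier
  g ^ zero  = ε
  g ^ suc k = g ∙ (g ^ k)

  IsOrder : Carrier → ℕ → Set
  IsOrder g k = (0 < k) × (g ^ k ≡ ε) × (∀ j → 0 < j → j < k → g ^ j ≢ ε)

  data ⟨_⟩ (T : Carrier → Set) : Carrier → Set where
    gen : ∀ {x} → T x → ⟨ T ⟩ x
    one : ⟨ T ⟩ ε
    mul : ∀ {x y} → ⟨ T ⟩ x → ⟨ T ⟩ y → ⟨ T ⟩ (x ∙ y)
    inv : ∀ {x} → ⟨ T ⟩ x → ⟨ T ⟩ (x ⁻¹)

  Cay : List Carrier → Carrier → Carrier → Set
  Cay S g h = Σ Carrier λ s' → s' ∈ S × h ≡ g ∙ s'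

HasSize : {A : Set} → (A → Set) → ℕ → Set
HasSize {A} P k =
  Σ (List A) λ l → Unique l × (∀ x → (x ∈ l) ⇔ P x) × length l ≡ k

data Walk {V : Set} (E : V → V → Set) : V → V → ℕ → Set where
  here : ∀ {x} → Walk E x x zero
  step : ∀ {x y z n} → E x y → Walk E y z n → Walk E x z (suc n)

Dist : {V : Set} → (V → V → Set) → V → V → ℕ → Set
Dist E x y i = Walk E x y i × (∀ j → j < i → ¬ Walk E x y j)

Connected : {V : Set} → (V → V → Set) → Set
Connected {V} E = ∀ (x y : V) → ∃ λ i → Dist E x y i

-- Γ is distance-regular with intersection numbers c_i, a_i, b_i.
-- c_i is only required for i ≥ 1 (N_{-1} is undefined; c_0 is conventionally 0).
-- For i larger than the diameter the conditions are vacuous.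
IsDistanceRegular : {V : Set} → (V → V → Set) → (c a b : ℕ → ℕ) → Set
IsDistanceRegular {V} E c a b =
  Connected E ×
  (∀ (x y : V) (i : ℕ) → Dist E x y i →
      (HasSize (λ z → Dist E x z i × E y z) (a i)) ×
      (HasSize (λ z → Dist E x z (suc i) × E y z) (b i))) ×
  (∀ (x y : V) (i : ℕ) → Dist E x y (suc i) →
      HasSize (λ z → Dist E x z i × E y z) (c (suc i)))

K222 : Fin 3 × Fin 2 → Fin 3 × Fin 2 → Set
K222 (p , _) (q , _) = p ≢ q

_≅G_ : {V W : Set} → (V → V → Set) → (W → W → Set) → Set
_≅G_ {V} {W} E F =
  Σ (V ↔ W) λ f → ∀ x y → E x y ⇔ F (Inverse.to f x) (Inverse.to f y)

{-# OPTIONS --safe #-}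
-- Write T = S ∖ {s, s⁻¹}, so H = ⟨T⟩, and s ∉ H since otherwise every vertex of the connected
-- graph would lie in H.  For w ∈ T with w ≠ s⁻² the vertex s·w lies outside H at distance 2 from 1;
-- a common neighbour z = (s·w)·s′ of 1 and s·w has z or s′ in {s, s⁻¹}, so there are at most two
-- of them when s²w ∉ S and the four s, s⁻¹, w, s²w when s²w ∈ S.  Constancy of c₂ therefore makes
-- "s²w ∈ S" independent of w.  Counting the a₁ = 2 common neighbours of 1 with s and with s² then
-- forces s² ∈ S, s⁴ ∈ S and T ⊆ {s², s⁻²}; as s⁴ ∈ T, s⁶ = 1.  So G = ⟨s⟩ is cyclic of order 6
-- and S = {s, s², s⁴, s⁵}: the Cayley graph is the circulant C₆(1,2,4,5), which is K₂,₂,₂.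
module Submission where

open import Defs
open import Level using (0ℓ)
open import Algebra.Bundles using (AbelianGroup)
open import Algebra.Structures using (IsAbelianGroup)
import Algebra.Properties.AbelianGroup as AbelianGroupProperties
open import Data.Nat using (ℕ; zero; suc; _+_; _*_; _∸_; _/_; _≤_; _<_; z≤n; s≤s; z<s; NonZero)
open import Data.Nat.Properties
  using (≤-trans; ≤-refl; +-suc; <-cmp; m<m+n; <⇒≤; ≤⇒≯; ≤-<-trans; m<1+n⇒m<n∨m≡n;
         m<n⇒0<n∸m; m∸n≤m; m+[n∸m]≡n)
  renaming (_≟_ to _≟ℕ_)
open import Data.Nat.DivMod using (_%_; _mod_; m%n<n; m≡m%n+[m/n]*n; m<n⇒m%n≡m)
open import Data.Fin using (Fin; toℕ)
open import Data.Fin.Properties using (toℕ-injective; toℕ<n; toℕ-fromℕ<; *↔×; all?)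
  renaming (_≟_ to _≟F_)
open import Data.Product using (Σ; _×_; _,_; proj₁; proj₂; ∃-syntax)
open import Data.Product.Algebra using (×-comm)
open import Data.Sum using (_⊎_; inj₁; inj₂)
open import Data.Empty using (⊥-elim)
open import Data.List using (List; []; _∷_; length; _++_)
open import Data.List.Properties using (length-++)
open import Data.List.Membership.Propositional using (_∈_; _∉_; find; lose)
open import Data.List.Membership.Propositional.Properties using (∈-∃++)
open import Data.List.Relation.Binary.Subset.Propositional using (_⊆_)
open import Data.List.Relation.Unary.Any using (Any; here; there; any?)
import Data.List.Relation.Unary.Any as Any
open import Data.List.Relation.Unary.All using (All; []; _∷_; lookup)
open import Data.List.Relation.Unary.AllPairs using ([]; _∷_)
open import Data.List.Relation.Unary.Unique.Propositional using (Unique)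
open import Relation.Binary using (DecidableEquality; tri<; tri≈; tri>)
open import Relation.Binary.PropositionalEquality
open import Relation.Nullary using (¬_; Dec; yes; no; contradiction)
open import Relation.Nullary.Decidable using (via-injection; toWitness; ¬?; _→-dec_; _×-dec_; map′)
open import Function.Bundles using (_↔_; _⇔_; Inverse; Equivalence; mk↔ₛ′; mk⇔)
open import Function.Base using (_∘_)
open import Function.Construct.Composition using (_↔-∘_; _⇔-∘_)
open import Function.Construct.Symmetry using (↔-sym)
open import Function.Properties.Inverse using (↔⇒↣)

module _ {A : Set} where

  private
    ∈-remove : ∀ {x y : A} us vs → y ∈ us ++ x ∷ vs → y ≢ x → y ∈ us ++ vs
    ∈-remove []       vs (here y≡x)  y≢x = ⊥-elim (y≢x y≡x)
    ∈-remove []       vs (there y∈)  _   = y∈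
    ∈-remove (u ∷ us) vs (here y≡u)  _   = here y≡u
    ∈-remove (u ∷ us) vs (there y∈)  y≢x = there (∈-remove us vs y∈ y≢x)

  Unique-⊆⇒length≤ : {xs ys : List A} → Unique xs → xs ⊆ ys → length xs ≤ length ys
  Unique-⊆⇒length≤ {[]}     _                xs⊆ys = z≤n
  Unique-⊆⇒length≤ {x ∷ xs} (x∉xs ∷ uniqueXs) xs⊆ys with ∈-∃++ (xs⊆ys (here refl))
  ... | us , vs , refl = begin
    suc (length xs)            ≤⟨ s≤s (Unique-⊆⇒length≤ uniqueXs xs⊆us++vs) ⟩
    suc (length (us ++ vs))    ≡⟨ cong suc (length-++ us) ⟩
    suc (length us + length vs) ≡⟨ sym (+-suc (length us) (length vs)) ⟩
    length us + length (x ∷ vs) ≡⟨ sym (length-++ us) ⟩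
    length (us ++ x ∷ vs)      ∎
    where
    open Data.Nat.Properties.≤-Reasoning
    xs⊆us++vs : xs ⊆ us ++ vs
    xs⊆us++vs z∈xs = ∈-remove us vs (xs⊆ys (there z∈xs)) (λ z≡x → lookup x∉xs z∈xs (sym z≡x))

  HasSize⇒length≤ : ∀ {P : A → Set} {n xs} → HasSize P n → Unique xs → All P xs → length xs ≤ n
  HasSize⇒length≤ (l , _ , l⇔P , refl) uniqueXs all-P =
    Unique-⊆⇒length≤ uniqueXs (λ x∈xs → Equivalence.from (l⇔P _) (lookup all-P x∈xs))

  HasSize⇒≤length : ∀ {P : A → Set} {n xs} → HasSize P n → (∀ x → P x → x ∈ xs) → n ≤ length xs
  HasSize⇒≤length (l , uniqueL , l⇔P , refl) P⊆xs =
    Unique-⊆⇒length≤ uniqueL (λ {x} x∈l → P⊆xs x (Equivalence.to (l⇔P x) x∈l))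

module _ {V : Set} {E : V → V → Set} where

  Walk-zero : ∀ {x y} → Walk E x y 0 → x ≡ y
  Walk-zero here = refl

  Walk-one : ∀ {x y} → Walk E x y 1 → E x y
  Walk-one (step e here) = e

  Walk-preserves : ∀ {P : V → Set} → (∀ {x y} → E x y → P x → P y) →
                   ∀ {x y n} → Walk E x y n → P x → P y
  Walk-preserves step-P here       Px = Px
  Walk-preserves step-P (step e w) Px = Walk-preserves step-P w (step-P e Px)

  Connected⇒invariant : ∀ {P : V → Set} → Connected E → (∀ {x y} → E x y → P x → P y) →
                        ∀ {x} → P x → ∀ y → P y
  Connected⇒invariant connected step-P {x} Px y =
    Walk-preserves step-P (proj₁ (proj₂ (connected x y))) Px

≅G-trans : ∀ {U V W : Set} {E : U → U → Set} {F : V → V → Set} {K : W → W → Set} →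
           E ≅G F → F ≅G K → E ≅G K
≅G-trans (f , E⇔F) (g , F⇔K) =
  g ↔-∘ f , λ x y → F⇔K (Inverse.to f x) (Inverse.to f y) ⇔-∘ E⇔F x y

≅G-fromInverse : ∀ {V W : Set} {E : V → V → Set} {F : W → W → Set} (f : W ↔ V) →
                 (∀ i j → E (Inverse.to f i) (Inverse.to f j) ⇔ F i j) → E ≅G F
≅G-fromInverse {E = E} {F} f adj = ↔-sym f , λ x y →
  subst₂ (λ x′ y′ → E x′ y′ ⇔ F (from x) (from y)) (strictlyInverseˡ x) (strictlyInverseˡ y)
         (adj (from x) (from y))
  where open Inverse f

Circulant : (n : ℕ) .{{_ : NonZero n}} → List ℕ → Fin n → Fin n → Set
Circulant n D i j = Any (λ d → toℕ j ≡ (toℕ i + d) % n) D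

-- i ↦ (i mod 3, i div 3): the parts of K₂,₂,₂ are the cosets {i, i + 3} of ⟨3⟩ in ℤ₆.
parts : Fin 6 ↔ (Fin 3 × Fin 2)
parts = ×-comm (Fin 2) (Fin 3) ↔-∘ *↔× {2} {3}

Circulant₆≅K222 : Circulant 6 (1 ∷ 2 ∷ 4 ∷ 5 ∷ []) ≅G K222
Circulant₆≅K222 = parts , toWitness {a? = all? λ i → all? λ j → adjacent? i j} _
  where
  _⇔?_ : ∀ {A B : Set} → Dec A → Dec B → Dec (A ⇔ B)
  A? ⇔? B? = map′ (λ (f , g) → mk⇔ f g) (λ A⇔B → Equivalence.to A⇔B , Equivalence.from A⇔B)
                  ((A? →-dec B?) ×-dec (B? →-dec A?))
  adjacent? : ∀ i j → Dec (Circulant 6 (1 ∷ 2 ∷ 4 ∷ 5 ∷ []) i j ⇔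
                          K222 (Inverse.to parts i) (Inverse.to parts j))
  adjacent? i j = any? (λ d → toℕ j ≟ℕ (toℕ i + d) % 6) _
                  ⇔? ¬? (proj₁ (Inverse.to parts i) ≟F proj₁ (Inverse.to parts j))

module _ (G : FiniteAbelianGroup) where
  open FiniteAbelianGroup G
  open IsAbelianGroup isAbelianGroup
    using (assoc; comm; identityˡ; identityʳ; inverseˡ; inverseʳ)

  private
    abelianGroup : AbelianGroup 0ℓ 0ℓ
    abelianGroup = record { isAbelianGroup = isAbelianGroup }

  open AbelianGroupProperties abelianGroup
    using (⁻¹-involutive; inverseʳ-unique; identityʳ-unique; identityˡ-unique; ∙-cancelˡ; xyx⁻¹≈y)

  infix 4 _≟_
  _≟_ : DecidableEquality Carrier
  _≟_ = via-injection (↔⇒↣ (↔-sym enum)) _≟F_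

  xy∙y⁻¹≡x : ∀ x y → x ∙ y ∙ y ⁻¹ ≡ x
  xy∙y⁻¹≡x x y = trans (cong (_∙ y ⁻¹) (comm x y)) (xyx⁻¹≈y y x)

  y∙[xy]⁻¹≡x⁻¹ : ∀ x y → y ∙ (x ∙ y) ⁻¹ ≡ x ⁻¹
  y∙[xy]⁻¹≡x⁻¹ x y = inverseʳ-unique x (y ∙ (x ∙ y) ⁻¹)
    (trans (sym (assoc x y _)) (inverseʳ (x ∙ y)))

  ∙≡⁻¹⇒≡⁻¹ : ∀ {x y z} → x ∙ y ≡ z ⁻¹ → y ≡ (z ∙ x) ⁻¹
  ∙≡⁻¹⇒≡⁻¹ {x} {y} {z} xy≡z⁻¹ = inverseʳ-unique (z ∙ x) y (begin
    z ∙ x ∙ y   ≡⟨ assoc z x y ⟩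
    z ∙ (x ∙ y) ≡⟨ cong (z ∙_) xy≡z⁻¹ ⟩
    z ∙ z ⁻¹    ≡⟨ inverseʳ z ⟩
    ε           ∎)
    where open ≡-Reasoning

  ≡⁻¹⇒∙≡ε : ∀ {x y} → x ≡ y ⁻¹ → y ∙ x ≡ ε
  ≡⁻¹⇒∙≡ε {y = y} x≡y⁻¹ = trans (cong (y ∙_) x≡y⁻¹) (inverseʳ y)

  ^-+ : ∀ g m n → g ^ (m + n) ≡ g ^ m ∙ g ^ n
  ^-+ g zero    n = sym (identityˡ _)
  ^-+ g (suc m) n = trans (cong (g ∙_) (^-+ g m n)) (sym (assoc _ _ _))

  module _ {g : Carrier} {n : ℕ} (gⁿ≡ε : g ^ n ≡ ε) where

    ^-*-≡ε : ∀ q → g ^ (q * n) ≡ ε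
    ^-*-≡ε zero    = refl
    ^-*-≡ε (suc q) = begin
      g ^ (n + q * n)       ≡⟨ ^-+ g n (q * n) ⟩
      g ^ n ∙ g ^ (q * n)   ≡⟨ cong₂ _∙_ gⁿ≡ε (^-*-≡ε q) ⟩
      ε ∙ ε                 ≡⟨ identityˡ ε ⟩
      ε                     ∎
      where open ≡-Reasoning

    ^-% : .{{_ : NonZero n}} → ∀ k → g ^ k ≡ g ^ (k % n)
    ^-% k = begin
      g ^ k                            ≡⟨ cong (g ^_) (m≡m%n+[m/n]*n k n) ⟩
      g ^ (k % n + (k / n) * n)        ≡⟨ ^-+ g (k % n) _ ⟩
      g ^ (k % n) ∙ g ^ ((k / n) * n)  ≡⟨ cong (g ^ (k % n) ∙_) (^-*-≡ε (k / n)) ⟩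
      g ^ (k % n) ∙ ε                  ≡⟨ identityʳ _ ⟩
      g ^ (k % n)                      ∎
      where open ≡-Reasoning

    ^-⁻¹ : ∀ k → k ≤ n → (g ^ k) ⁻¹ ≡ g ^ (n ∸ k)
    ^-⁻¹ k k≤n = sym (inverseʳ-unique (g ^ k) (g ^ (n ∸ k))
      (trans (sym (^-+ g k (n ∸ k))) (trans (cong (g ^_) (m+[n∸m]≡n k≤n)) gⁿ≡ε)))

  powers≢ε-below-order : ∀ {g n} → (∀ k → IsOrder g k → n ≤ k) → ∀ j → 0 < j → j < n → g ^ j ≢ ε
  powers≢ε-below-order {g} {n} bound j = below n ≤-refl j
    where
    below : ∀ m → m ≤ n → ∀ j → 0 < j → j < m → g ^ j ≢ ε
    below (suc m) 1+m≤n j 0<j j<1+m gʲ≡ε with m<1+n⇒m<n∨m≡n j<1+m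
    ... | inj₁ j<m  = below m (<⇒≤ 1+m≤n) j 0<j j<m gʲ≡ε
    ... | inj₂ refl = ≤⇒≯ (bound j (0<j , gʲ≡ε , below j (<⇒≤ 1+m≤n))) 1+m≤n

  module _ {g : Carrier} {n : ℕ} (noSmall : ∀ j → 0 < j → j < n → g ^ j ≢ ε) where

    ^-distinct : ∀ {i j} → i < j → j < n → g ^ i ≢ g ^ j
    ^-distinct {i} {j} i<j j<n gⁱ≡gʲ =
      noSmall (j ∸ i) (m<n⇒0<n∸m i<j) (≤-<-trans (m∸n≤m j i) j<n)
        (identityʳ-unique (g ^ i) (g ^ (j ∸ i))
          (trans (sym (^-+ g i (j ∸ i))) (trans (cong (g ^_) (m+[n∸m]≡n (<⇒≤ i<j))) (sym gⁱ≡gʲ))))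

    ^-injective : ∀ {i j} → i < n → j < n → g ^ i ≡ g ^ j → i ≡ j
    ^-injective {i} {j} i<n j<n gⁱ≡gʲ with <-cmp i j
    ... | tri< i<j _ _ = ⊥-elim (^-distinct i<j j<n gⁱ≡gʲ)
    ... | tri≈ _ i≡j _ = i≡j
    ... | tri> _ _ j<i = ⊥-elim (^-distinct j<i i<n (sym gⁱ≡gʲ))

  module Cyclic {g : Carrier} {n : ℕ} .{{_ : NonZero n}} (order : IsOrder g n) where

    private
      gⁿ≡ε = proj₁ (proj₂ order)
      noSmall = proj₂ (proj₂ order)

    ^≡^⇒%≡% : ∀ {a b} → g ^ a ≡ g ^ b → a % n ≡ b % n
    ^≡^⇒%≡% {a} {b} gᵃ≡gᵇ = ^-injective noSmall (m%n<n a n) (m%n<n b n)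
      (trans (sym (^-% gⁿ≡ε a)) (trans gᵃ≡gᵇ (^-% gⁿ≡ε b)))

    module _ (generated : ∀ x → ∃[ k ] x ≡ g ^ k) where

      exponent : Carrier → Fin n
      exponent x = proj₁ (generated x) mod n

      toℕ-exponent : ∀ x → toℕ (exponent x) ≡ proj₁ (generated x) % n
      toℕ-exponent x = toℕ-fromℕ< (m%n<n (proj₁ (generated x)) n)

      powers↔ : Fin n ↔ Carrier
      powers↔ = mk↔ₛ′ (λ i → g ^ toℕ i) exponent power-exponent exponent-power
        where
        power-exponent : ∀ x → g ^ toℕ (exponent x) ≡ x
        power-exponent x = begin
          g ^ toℕ (exponent x)              ≡⟨ cong (g ^_) (toℕ-exponent x) ⟩
          g ^ (proj₁ (generated x) % n)     ≡⟨ sym (^-% gⁿ≡ε _) ⟩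
          g ^ proj₁ (generated x)           ≡⟨ sym (proj₂ (generated x)) ⟩
          x                                 ∎
          where open ≡-Reasoning
        exponent-power : ∀ i → exponent (g ^ toℕ i) ≡ i
        exponent-power i = toℕ-injective (begin
          toℕ (exponent (g ^ toℕ i))          ≡⟨ toℕ-exponent (g ^ toℕ i) ⟩
          proj₁ (generated (g ^ toℕ i)) % n   ≡⟨ ^≡^⇒%≡% (sym (proj₂ (generated (g ^ toℕ i)))) ⟩
          toℕ i % n                           ≡⟨ m<n⇒m%n≡m (toℕ<n i) ⟩
          toℕ i                               ∎)
          where open ≡-Reasoning

    module _ {S : List Carrier} {D : List ℕ} (S⇔powers : ∀ x → x ∈ S ⇔ Any (λ d → x ≡ g ^ d) D) where

      Cay-powers⇔Circulant : ∀ i j → Cay S (g ^ toℕ i) (g ^ toℕ j) ⇔ Circulant n D i j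
      Cay-powers⇔Circulant i j = mk⇔ to from
        where
        to : Cay S (g ^ toℕ i) (g ^ toℕ j) → Circulant n D i j
        to (x , x∈S , gʲ≡gⁱx) = Any.map exponent-shift (Equivalence.to (S⇔powers x) x∈S)
          where
          exponent-shift : ∀ {d} → x ≡ g ^ d → toℕ j ≡ (toℕ i + d) % n
          exponent-shift {d} x≡gᵈ = begin
            toℕ j            ≡⟨ sym (m<n⇒m%n≡m (toℕ<n j)) ⟩
            toℕ j % n        ≡⟨ ^≡^⇒%≡% gʲ≡gⁱ⁺ᵈ ⟩
            (toℕ i + d) % n  ∎
            where
            open ≡-Reasoning
            gʲ≡gⁱ⁺ᵈ : g ^ toℕ j ≡ g ^ (toℕ i + d)
            gʲ≡gⁱ⁺ᵈ = trans gʲ≡gⁱx (trans (cong (g ^ toℕ i ∙_) x≡gᵈ) (sym (^-+ g (toℕ i) d)))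
        from : Circulant n D i j → Cay S (g ^ toℕ i) (g ^ toℕ j)
        from circ with find circ
        ... | d , d∈D , j≡i+d = g ^ d , Equivalence.from (S⇔powers (g ^ d)) (lose d∈D refl) , (begin
          g ^ toℕ j                ≡⟨ cong (g ^_) j≡i+d ⟩
          g ^ ((toℕ i + d) % n)    ≡⟨ sym (^-% gⁿ≡ε _) ⟩
          g ^ (toℕ i + d)          ≡⟨ ^-+ g (toℕ i) d ⟩
          g ^ toℕ i ∙ g ^ d        ∎)
          where open ≡-Reasoning

      Cay≅Circulant : (∀ x → ∃[ k ] x ≡ g ^ k) → Cay S ≅G Circulant n D
      Cay≅Circulant generated = ≅G-fromInverse (powers↔ generated) Cay-powers⇔Circulant

  module CayleyNeighbours (S : List Carrier) (S-inv : ∀ x → x ∈ S → x ⁻¹ ∈ S) (ε∉S : ε ∉ S)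
    (s : Carrier) (s∈S : s ∈ S) where

    open import Data.List.Membership.DecPropositional _≟_ using (_∈?_)

    s² s³ s⁴ : Carrier
    s² = s ∙ s
    s³ = s ∙ s²
    s⁴ = s ∙ s³

    T : Carrier → Set
    T x = x ∈ S × x ≢ s × x ≢ s ⁻¹

    H : Carrier → Set
    H = ⟨ T ⟩

    Common : Carrier → Carrier → Set
    Common y z = Dist (Cay S) ε z 1 × Cay S y z

    ∈S⇒≢ε : ∀ {x} → x ∈ S → x ≢ ε
    ∈S⇒≢ε x∈S refl = ε∉S x∈S

    Cay-irrefl : ∀ {x} → ¬ Cay S x x
    Cay-irrefl {x} (x′ , x′∈S , x≡xx′) = ∈S⇒≢ε x′∈S (identityʳ-unique x x′ (sym x≡xx′))

    Cay-ε : ∀ {z} → Cay S ε z → z ∈ S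
    Cay-ε (x , x∈S , z≡εx) = subst (_∈ S) (sym (trans z≡εx (identityˡ x))) x∈S

    ∈S⇒Dist1 : ∀ {z} → z ∈ S → Dist (Cay S) ε z 1
    ∈S⇒Dist1 {z} z∈S = step (z , z∈S , sym (identityˡ z)) here , shorter
      where
      shorter : ∀ j → j < 1 → ¬ Walk (Cay S) ε z j
      shorter zero _ w = ∈S⇒≢ε z∈S (sym (Walk-zero w))
      shorter (suc _) (s≤s ())

    Dist2 : ∀ {x w} → x ∈ S → w ∈ S → x ∙ w ∉ S → x ∙ w ≢ ε → Dist (Cay S) ε (x ∙ w) 2
    Dist2 {x} {w} x∈S w∈S xw∉S xw≢ε =
      step (x , x∈S , sym (identityˡ x)) (step (w , w∈S , refl) here) , shorter
      where
      shorter : ∀ j → j < 2 → ¬ Walk (Cay S) ε (x ∙ w) j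
      shorter zero          _ walk = xw≢ε (sym (Walk-zero walk))
      shorter (suc zero)    _ walk = xw∉S (Cay-ε (Walk-one walk))
      shorter (suc (suc _)) (s≤s (s≤s ()))

    common⁺ : ∀ {y z s′} → z ∈ S → s′ ∈ S → z ≡ y ∙ s′ → Common y z
    common⁺ z∈S s′∈S z≡ys′ = ∈S⇒Dist1 z∈S , _ , s′∈S , z≡ys′

    common⁻ : ∀ {y z} → Common y z → ∃[ s′ ] z ∈ S × s′ ∈ S × z ≡ y ∙ s′
    common⁻ ((walk , _) , s′ , s′∈S , z≡ys′) = s′ , Cay-ε (Walk-one walk) , s′∈S , z≡ys′

    Common⇒∈S : ∀ {y z} → Common y z → z ∈ S
    Common⇒∈S c = proj₁ (proj₂ (common⁻ c))

    classify : ∀ {x} → x ∈ S → x ≡ s ⊎ x ≡ s ⁻¹ ⊎ T x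
    classify {x} x∈S with x ≟ s | x ≟ s ⁻¹
    ... | yes x≡s | _          = inj₁ x≡s
    ... | no _    | yes x≡s⁻¹  = inj₂ (inj₁ x≡s⁻¹)
    ... | no x≢s  | no x≢s⁻¹   = inj₂ (inj₂ (x∈S , x≢s , x≢s⁻¹))

    ∉H-∙ : ∀ {x h} → ¬ H x → H h → ¬ H (x ∙ h)
    ∉H-∙ {x} {h} x∉H h∈H xh∈H = x∉H (subst H (xy∙y⁻¹≡x x h) (mul xh∈H (inv h∈H)))

    H-separates : ∀ {x y} → ¬ H x → H y → x ≢ y
    H-separates x∉H y∈H refl = x∉H y∈H

    s²∙-∈H : ∀ {w} → H s² → H w → H (s ∙ (s ∙ w))
    s²∙-∈H {w} s²∈H w∈H = subst H (assoc s s w) (mul s²∈H w∈H)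

    Common-s²⇒≡s⊎≡s²t : ∀ {z} → s³ ∉ S → Common s² z → z ≡ s ⊎ ∃[ t ] T t × z ≡ s ∙ (s ∙ t)
    Common-s²⇒≡s⊎≡s²t s³∉S c with common⁻ c
    ... | s′ , z∈S , s′∈S , z≡s²s′ with classify s′∈S
    ...   | inj₁ s′≡s = ⊥-elim (s³∉S (subst (_∈ S) s³-form z∈S))
      where s³-form = trans z≡s²s′ (trans (cong (s² ∙_) s′≡s) (comm s² s))
    ...   | inj₂ (inj₁ s′≡s⁻¹) = inj₁ (trans z≡s²s′ (trans (cong (s² ∙_) s′≡s⁻¹) (xy∙y⁻¹≡x s s)))
    ...   | inj₂ (inj₂ Ts′)    = inj₂ (s′ , Ts′ , trans z≡s²s′ (assoc s s s′))

    module _ (s∉H : ¬ H s) where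

      s⁻¹∉H : ¬ H (s ⁻¹)
      s⁻¹∉H s⁻¹∈H = s∉H (subst H (⁻¹-involutive s) (inv s⁻¹∈H))

      Common⇒≡s⊎≡ys⁻¹ : ∀ {y z} → ¬ H y → y ∙ s ∉ S → Common y z → z ≡ s ⊎ z ≡ y ∙ s ⁻¹
      Common⇒≡s⊎≡ys⁻¹ {y} y∉H ys∉S c with common⁻ c
      ... | s′ , z∈S , s′∈S , z≡ys′ with classify s′∈S
      ...   | inj₁ s′≡s = ⊥-elim (ys∉S (subst (_∈ S) (trans z≡ys′ (cong (y ∙_) s′≡s)) z∈S))
      ...   | inj₂ (inj₁ s′≡s⁻¹) = inj₂ (trans z≡ys′ (cong (y ∙_) s′≡s⁻¹))
      ...   | inj₂ (inj₂ Ts′) with classify z∈S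
      ...     | inj₁ z≡s = inj₁ z≡s
      ...     | inj₂ (inj₁ z≡s⁻¹) = ⊥-elim (ys∉S (subst (_∈ S) s′⁻¹≡ys (S-inv _ s′∈S)))
        where
        s′⁻¹≡ys : s′ ⁻¹ ≡ y ∙ s
        s′⁻¹≡ys = trans (cong _⁻¹ (∙≡⁻¹⇒≡⁻¹ (trans (sym z≡ys′) z≡s⁻¹)))
                          (trans (⁻¹-involutive (s ∙ y)) (comm s y))
      ...     | inj₂ (inj₂ Tz) = ⊥-elim (∉H-∙ y∉H (gen Ts′) (subst H z≡ys′ (gen Tz)))

      s∙w∉S : ∀ {w} → T w → w ≢ s² ⁻¹ → s ∙ w ∉ S
      s∙w∉S {w} Tw@(w∈S , _ , _) w≢s⁻² sw∈S with classify sw∈S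
      ... | inj₁ sw≡s          = ∈S⇒≢ε w∈S (identityʳ-unique s w sw≡s)
      ... | inj₂ (inj₁ sw≡s⁻¹) = w≢s⁻² (∙≡⁻¹⇒≡⁻¹ sw≡s⁻¹)
      ... | inj₂ (inj₂ Tsw)    = ∉H-∙ s∉H (gen Tw) (gen Tsw)

      Dist2-s∙w : ∀ {w} → T w → w ≢ s² ⁻¹ → Dist (Cay S) ε (s ∙ w) 2
      Dist2-s∙w Tw@(w∈S , _ , _) w≢s⁻² =
        Dist2 s∈S w∈S (s∙w∉S Tw w≢s⁻²) (λ sw≡ε → ∉H-∙ s∉H (gen Tw) (subst H (sym sw≡ε) one))

      Common-s∙w-size≥4 : ∀ {w k} → s² ≢ ε → H s² → T w → s ∙ (s ∙ w) ∈ S →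
                          HasSize (Common (s ∙ w)) k → 4 ≤ k
      Common-s∙w-size≥4 {w} s²≢ε s²∈H Tw@(w∈S , _ , _) s²w∈S size =
        HasSize⇒length≤ size distinct commons
        where
        w∈H = gen Tw
        s²w∈H = s²∙-∈H s²∈H w∈H
        commons : All (Common (s ∙ w)) (s ∷ s ⁻¹ ∷ w ∷ s ∙ (s ∙ w) ∷ [])
        commons = common⁺ s∈S (S-inv w w∈S) (sym (xy∙y⁻¹≡x s w))
                ∷ common⁺ (S-inv s s∈S) (S-inv _ s²w∈S) (sym (y∙[xy]⁻¹≡x⁻¹ s (s ∙ w)))
                ∷ common⁺ w∈S (S-inv s s∈S) (sym (xyx⁻¹≈y s w))
                ∷ common⁺ s²w∈S s∈S (comm s (s ∙ w))
                ∷ []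
        distinct : Unique (s ∷ s ⁻¹ ∷ w ∷ s ∙ (s ∙ w) ∷ [])
        distinct = (s²≢ε ∘ ≡⁻¹⇒∙≡ε ∷ H-separates s∉H w∈H ∷ H-separates s∉H s²w∈H ∷ [])
                 ∷ (H-separates s⁻¹∉H w∈H ∷ H-separates s⁻¹∉H s²w∈H ∷ [])
                 ∷ ((λ w≡s²w → s²≢ε (identityˡ-unique s² w (trans (assoc s s w) (sym w≡s²w)))) ∷ [])
                 ∷ [] ∷ []

    module DistanceRegular (outside-H : Σ Carrier (λ g → ¬ H g)) (order≥6 : ∀ k → IsOrder s k → 6 ≤ k)
      (c a b : ℕ → ℕ) (drg : IsDistanceRegular (Cay S) c a b) (a₁≡2 : a 1 ≡ 2) where

      ^1≡s : s ^ 1 ≡ s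
      ^1≡s = identityʳ s
      ^2≡s² : s ^ 2 ≡ s²
      ^2≡s² = cong (s ∙_) ^1≡s
      ^3≡s³ : s ^ 3 ≡ s³
      ^3≡s³ = cong (s ∙_) ^2≡s²
      ^4≡s⁴ : s ^ 4 ≡ s⁴
      ^4≡s⁴ = cong (s ∙_) ^3≡s³

      s^≢ε : ∀ j → 0 < j → j < 6 → s ^ j ≢ ε
      s^≢ε = powers≢ε-below-order order≥6

      s²≢ε : s² ≢ ε
      s²≢ε = s^≢ε 2 z<s (m<m+n 2 z<s) ∘ trans ^2≡s²

      s≢ε : s ≢ ε
      s≢ε = ∈S⇒≢ε s∈S

      s∉H : ¬ H s
      s∉H s∈H = proj₂ outside-H (Connected⇒invariant (proj₁ drg) step-in-H one (proj₁ outside-H))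
        where
        S⊆H : ∀ {x} → x ∈ S → H x
        S⊆H x∈S with classify x∈S
        ... | inj₁ refl        = s∈H
        ... | inj₂ (inj₁ refl) = inv s∈H
        ... | inj₂ (inj₂ Tx)   = gen Tx
        step-in-H : ∀ {x y} → Cay S x y → H x → H y
        step-in-H (x′ , x′∈S , y≡xx′) x∈H = subst H (sym y≡xx′) (mul x∈H (S⊆H x′∈S))

      a₁-size : ∀ {y} → y ∈ S → HasSize (Common y) 2
      a₁-size y∈S = subst (HasSize (Common _)) a₁≡2 (proj₁ (proj₁ (proj₂ drg) ε _ 1 (∈S⇒Dist1 y∈S)))

      c₂-size : ∀ {y} → Dist (Cay S) ε y 2 → HasSize (Common y) (c 2)
      c₂-size = proj₂ (proj₂ drg) ε _ 1

      s²∈S : s² ∈ S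
      s²∈S with s² ∈? S
      ... | yes s²∈S = s²∈S
      ... | no  s²∉S = contradiction (HasSize⇒≤length (a₁-size s∈S) no-common) λ ()
        where
        no-common : ∀ z → Common s z → z ∈ []
        no-common z c with Common⇒≡s⊎≡ys⁻¹ s∉H s∉H s²∉S c
        ... | inj₁ refl    = ⊥-elim (Cay-irrefl (proj₂ c))
        ... | inj₂ z≡ss⁻¹  = ⊥-elim (∈S⇒≢ε (Common⇒∈S c) (trans z≡ss⁻¹ (inverseʳ s)))

      Ts² : T s²
      Ts² = s²∈S , s≢ε ∘ identityʳ-unique s s , s^≢ε 3 z<s (m<m+n 3 z<s) ∘ trans ^3≡s³ ∘ ≡⁻¹⇒∙≡ε

      s²∈H : H s²
      s²∈H = gen Ts²

      s²≢s⁻² : s² ≢ s² ⁻¹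
      s²≢s⁻² = s^≢ε 4 z<s (m<m+n 4 z<s) ∘ trans ^4≡s⁴ ∘ trans (sym (assoc s s s²)) ∘ ≡⁻¹⇒∙≡ε

      s³∉S : s³ ∉ S
      s³∉S = s∙w∉S s∉H Ts² s²≢s⁻²

      c₂≤2 : ∀ {w} → T w → w ≢ s² ⁻¹ → s ∙ (s ∙ w) ∉ S → c 2 ≤ 2
      c₂≤2 {w} Tw w≢s⁻² s²w∉S = HasSize⇒≤length (c₂-size (Dist2-s∙w s∉H Tw w≢s⁻²)) two-candidates
        where
        two-candidates : ∀ z → Common (s ∙ w) z → z ∈ s ∷ s ∙ w ∙ s ⁻¹ ∷ []
        two-candidates z c
          with Common⇒≡s⊎≡ys⁻¹ s∉H (∉H-∙ s∉H (gen Tw)) (s²w∉S ∘ subst (_∈ S) (comm (s ∙ w) s)) c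
        ... | inj₁ z≡s       = here z≡s
        ... | inj₂ z≡sws⁻¹   = there (here z≡sws⁻¹)

      4≤c₂ : ∀ {w} → T w → w ≢ s² ⁻¹ → s ∙ (s ∙ w) ∈ S → 4 ≤ c 2
      4≤c₂ Tw w≢s⁻² s²w∈S = Common-s∙w-size≥4 s∉H s²≢ε s²∈H Tw s²w∈S (c₂-size (Dist2-s∙w s∉H Tw w≢s⁻²))

      s²w∈S-transfer : ∀ {w w′} → T w → w ≢ s² ⁻¹ → T w′ → w′ ≢ s² ⁻¹ →
                     s ∙ (s ∙ w) ∈ S → s ∙ (s ∙ w′) ∈ S
      s²w∈S-transfer {w′ = w′} Tw w≢s⁻² Tw′ w′≢s⁻² s²w∈S with s ∙ (s ∙ w′) ∈? S
      ... | yes s²w′∈S = s²w′∈S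
      ... | no  s²w′∉S =
        contradiction (≤-trans (4≤c₂ Tw w≢s⁻² s²w∈S) (c₂≤2 Tw′ w′≢s⁻² s²w′∉S)) λ { (s≤s (s≤s ())) }

      s⁴∈S : s⁴ ∈ S
      s⁴∈S with s⁴ ∈? S
      ... | yes s⁴∈S = s⁴∈S
      ... | no  s⁴∉S = contradiction (HasSize⇒≤length (a₁-size s²∈S) only-s) λ { (s≤s ()) }
        where
        s²t∉S : ∀ {t} → T t → s ∙ (s ∙ t) ∉ S
        s²t∉S {t} Tt s²t∈S with t ≟ s² ⁻¹
        ... | yes refl  = ∈S⇒≢ε s²t∈S (trans (sym (assoc s s _)) (inverseʳ s²))
        ... | no t≢s⁻²  = s⁴∉S (s²w∈S-transfer Tt t≢s⁻² Ts² s²≢s⁻² s²t∈S)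
        only-s : ∀ z → Common s² z → z ∈ s ∷ []
        only-s z c with Common-s²⇒≡s⊎≡s²t s³∉S c
        ... | inj₁ z≡s             = here z≡s
        ... | inj₂ (t , Tt , z≡s²t) = ⊥-elim (s²t∉S Tt (subst (_∈ S) z≡s²t (Common⇒∈S c)))

      T⊆s²± : ∀ {t} → T t → t ≡ s² ⊎ t ≡ s² ⁻¹
      T⊆s²± {t} Tt with t ≟ s² | t ≟ s² ⁻¹
      ... | yes t≡s² | _           = inj₁ t≡s²
      ... | no _     | yes t≡s⁻²   = inj₂ t≡s⁻²
      ... | no t≢s²  | no t≢s⁻²    =
        contradiction (HasSize⇒length≤ (a₁-size s²∈S) distinct commons) λ { (s≤s (s≤s ())) }
        where
        s²t∈S = s²w∈S-transfer Ts² s²≢s⁻² Tt t≢s⁻² s⁴∈S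
        commons : All (Common s²) (s ∷ s ∙ (s ∙ t) ∷ s⁴ ∷ [])
        commons = common⁺ s∈S (S-inv s s∈S) (sym (xy∙y⁻¹≡x s s))
                ∷ common⁺ s²t∈S (proj₁ Tt) (sym (assoc s s t))
                ∷ common⁺ s⁴∈S s²∈S (sym (assoc s s s²))
                ∷ []
        distinct : Unique (s ∷ s ∙ (s ∙ t) ∷ s⁴ ∷ [])
        distinct = (H-separates s∉H (s²∙-∈H s²∈H (gen Tt)) ∷ H-separates s∉H (s²∙-∈H s²∈H s²∈H) ∷ [])
                 ∷ ((λ s²t≡s⁴ → t≢s² (∙-cancelˡ s _ _ (∙-cancelˡ s _ _ s²t≡s⁴))) ∷ [])
                 ∷ [] ∷ []

      s⁴≢s : s⁴ ≢ s
      s⁴≢s = s^≢ε 3 z<s (m<m+n 3 z<s) ∘ trans ^3≡s³ ∘ identityʳ-unique s s³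

      s⁴≢s⁻¹ : s⁴ ≢ s ⁻¹
      s⁴≢s⁻¹ = s^≢ε 5 z<s (m<m+n 5 z<s) ∘ trans (cong (s ∙_) ^4≡s⁴) ∘ ≡⁻¹⇒∙≡ε

      s⁶≡ε : s ^ 6 ≡ ε
      s⁶≡ε with T⊆s²± (s⁴∈S , s⁴≢s , s⁴≢s⁻¹)
      ... | inj₁ s⁴≡s²  = ⊥-elim (s²≢ε (identityˡ-unique s² s² (trans (assoc s s s²) s⁴≡s²)))
      ... | inj₂ s⁴≡s⁻² = begin
        s ^ 6        ≡⟨ cong (λ x → s ∙ (s ∙ x)) ^4≡s⁴ ⟩
        s ∙ (s ∙ s⁴) ≡⟨ sym (assoc s s s⁴) ⟩
        s² ∙ s⁴      ≡⟨ ≡⁻¹⇒∙≡ε s⁴≡s⁻² ⟩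
        ε            ∎
        where open ≡-Reasoning

      order6 : IsOrder s 6
      order6 = z<s , s⁶≡ε , s^≢ε

      S⇔powers : ∀ x → x ∈ S ⇔ Any (λ d → x ≡ s ^ d) (1 ∷ 2 ∷ 4 ∷ 5 ∷ [])
      S⇔powers x = mk⇔ to from
        where
        s⁻¹≡s⁵ : s ⁻¹ ≡ s ^ 5
        s⁻¹≡s⁵ = trans (cong _⁻¹ (sym ^1≡s)) (^-⁻¹ {n = 6} s⁶≡ε 1 (s≤s z≤n))
        s⁻²≡s⁴ : s² ⁻¹ ≡ s ^ 4
        s⁻²≡s⁴ = trans (cong _⁻¹ (sym ^2≡s²)) (^-⁻¹ {n = 6} s⁶≡ε 2 (s≤s (s≤s z≤n)))
        to : x ∈ S → Any (λ d → x ≡ s ^ d) (1 ∷ 2 ∷ 4 ∷ 5 ∷ [])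
        to x∈S with classify x∈S
        ... | inj₁ x≡s         = here (trans x≡s (sym ^1≡s))
        ... | inj₂ (inj₁ x≡s⁻¹) = there (there (there (here (trans x≡s⁻¹ s⁻¹≡s⁵))))
        ... | inj₂ (inj₂ Tx) with T⊆s²± Tx
        ...   | inj₁ x≡s²  = there (here (trans x≡s² (sym ^2≡s²)))
        ...   | inj₂ x≡s⁻² = there (there (here (trans x≡s⁻² s⁻²≡s⁴)))
        from : Any (λ d → x ≡ s ^ d) (1 ∷ 2 ∷ 4 ∷ 5 ∷ []) → x ∈ S
        from (here refl)                         = subst (_∈ S) (sym ^1≡s) s∈S
        from (there (here refl))                 = subst (_∈ S) (sym ^2≡s²) s²∈S
        from (there (there (here refl)))         = subst (_∈ S) (sym ^4≡s⁴) s⁴∈S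
        from (there (there (there (here refl)))) = subst (_∈ S) s⁻¹≡s⁵ (S-inv s s∈S)

      generated : ∀ x → ∃[ k ] x ≡ s ^ k
      generated = Connected⇒invariant {P = λ x → ∃[ k ] x ≡ s ^ k} (proj₁ drg) step-power (0 , refl)
        where
        step-power : ∀ {x y} → Cay S x y → ∃[ k ] x ≡ s ^ k → ∃[ k ] y ≡ s ^ k
        step-power (x′ , x′∈S , y≡xx′) (k , x≡sᵏ) with find (Equivalence.to (S⇔powers x′) x′∈S)
        ... | d , _ , x′≡sᵈ = k + d , trans y≡xx′ (trans (cong₂ _∙_ x≡sᵏ x′≡sᵈ) (sym (^-+ s k d)))

      Cay≅K222 : Cay S ≅G K222
      Cay≅K222 = ≅G-trans {K = K222} (Cyclic.Cay≅Circulant order6 S⇔powers generated) Circulant₆≅K222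

proposition6p3 :
    (G : FiniteAbelianGroup) → let open FiniteAbelianGroup G in
    (S : List Carrier) → Unique S →
    (∀ x → x ∈ S → x ⁻¹ ∈ S) →
    ε ∉ S →
    3 ≤ length S →
    (s : Carrier) → s ∈ S →
    let H = ⟨ (λ x → x ∈ S × x ≢ s × x ≢ s ⁻¹) ⟩ in
    Σ Carrier (λ g → ¬ H g) →
    (m : ℕ) → HasSize H m → size ≡ 2 * m →
    (∀ k → IsOrder s k → 6 ≤ k) →
    (c a b : ℕ → ℕ) → IsDistanceRegular (Cay S) c a b →
    a 1 ≡ 2 →
    Cay S ≅G K222
proposition6p3 G S _ S-inv ε∉S _ s s∈S outside-H _ _ _ order≥6 c a b drg a₁≡2 =
  CayleyNeighbours.DistanceRegular.Cay≅K222 G S S-inv ε∉S s s∈S outside-H order≥6 c a b drg a₁≡2
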